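{- Let $(H,+)$ be an abelian group with a norm $\|\cdot\|$, let $c\in\mathbb{R}_{\ge0}$, and let $f:\mathbb{Z}\to H$ be a map with $f(1)=0$. Define $\Delta(x)=f(x+1)-f(x)$ for $x\in\mathbb{Z}$. Then $f$ is a $c$-quasihomomorphism if and only if for all $k\in\mathbb{Z}_{\ge0}$ and all $z\in\mathbb{Z}$ we have \[\Big\|\sum_{i=1}^{k}\Delta(i)-\sum_{i=0}^{k}\Delta(z-i)\Big\|\le c\quad\text{and}\quad \Big\|\sum_{i=0}^{k}\Delta(-i)-\sum_{i=0}^{k-1}\Delta(z-i)\Big\|\le c,\] where empty sums are $0$.
   Context: A norm on an abelian group $H$ is a map $\|\cdot\|:H\to\mathbb{R}$ with $\|x\|\ge0$, equality iff $x=0$, $\|x+y\|\le\|x\|+\|y\|$, and $\|-x\|=\|x\|$. A map $f:\mathbb{Z}\to H$ is a $c$-quasihomomorphism if $\|f(x+y)-f(x)-f(y)\|\le c$ for all $x,y\in\mathbb{Z}$. -}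

module Defs where

open import Level using (Level; _⊔_; suc)
open import Data.Nat using (ℕ; zero; suc)
open import Data.Integer using (ℤ; +_; -_) renaming (_+_ to _+ℤ_; _-_ to _-ℤ_)
open import Algebra.Bundles using (AbelianGroup)
open import Algebra.Structures using (IsCommutativeMonoid)
open import Relation.Binary.Structures using (IsPartialOrder)
open import Relation.Binary.Core using (Rel)
open import Function.Bundles using (_⇔_)

-- The stdlib has no real numbers.  Norm values are taken in an arbitrary
-- partially ordered commutative monoid (V, +, 0, ≤) with + monotone;
-- (ℝ, +, 0, ≤) is an instance of this structure.
record OrderedCommMonoid (a ℓ₁ ℓ₂ : Level) : Set (Level.suc (a ⊔ ℓ₁ ⊔ ℓ₂)) where
  infixl 6 _+_
  infix 4 _≈_ _≤_
  field
    Carrier : Set a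
    _≈_ : Rel Carrier ℓ₁
    _≤_ : Rel Carrier ℓ₂
    _+_ : Carrier → Carrier → Carrier
    0#  : Carrier
    isCommutativeMonoid : IsCommutativeMonoid _≈_ _+_ 0#
    isPartialOrder : IsPartialOrder _≈_ _≤_
    +-mono-≤ : ∀ {x y u v} → x ≤ y → u ≤ v → x + u ≤ y + v

module _ {a ℓ a' ℓ₁ ℓ₂ : Level} (H : AbelianGroup a ℓ) (V : OrderedCommMonoid a' ℓ₁ ℓ₂) where
  private
    module H = AbelianGroup H
    module V = OrderedCommMonoid V

  record IsNorm (‖_‖ : H.Carrier → V.Carrier) : Set (a ⊔ ℓ ⊔ ℓ₁ ⊔ ℓ₂) where
    field
      cong      : ∀ {x y} → x H.≈ y → ‖ x ‖ V.≈ ‖ y ‖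
      nonneg    : ∀ x → V.0# V.≤ ‖ x ‖
      zero-iff  : ∀ x → (‖ x ‖ V.≈ V.0#) ⇔ (x H.≈ H.ε)
      triangle  : ∀ x y → ‖ x H.∙ y ‖ V.≤ ‖ x ‖ V.+ ‖ y ‖
      symmetric : ∀ x → ‖ H._⁻¹ x ‖ V.≈ ‖ x ‖

  _-H_ : H.Carrier → H.Carrier → H.Carrier
  x -H y = x H.∙ (H._⁻¹ y)

  IsQuasiHom : (‖_‖ : H.Carrier → V.Carrier) → V.Carrier → (ℤ → H.Carrier) → Set ℓ₂
  IsQuasiHom ‖_‖ c f = ∀ x y → ‖ (f (x +ℤ y) -H f x) -H f y ‖ V.≤ c

  Δ : (ℤ → H.Carrier) → ℤ → H.Carrier
  Δ f x = f (x +ℤ + 1) -H f x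

  sumBelow : ℕ → (ℕ → H.Carrier) → H.Carrier
  sumBelow zero    g = H.ε
  sumBelow (suc n) g = sumBelow n g H.∙ g n

{-# OPTIONS --safe #-}
-- Both sums telescope. Since f(1) = 0, the first expression is the inverse of the
-- defect f(x + y) - f(x) - f(y) at (x, y) = (k + 1, z - k) and the second is the
-- defect at (x, y) = (-k, z + 1). As k ranges over ℕ and z over ℤ these pairs cover
-- all of ℤ², and a norm is invariant under inversion.
module Submission where

open import Defs
open import Level using (Level)
open import Data.Nat using (ℕ; zero; suc)
open import Data.Integer using (ℤ; +_; -_; -[1+_]) renaming (_+_ to _+ℤ_; _-_ to _-ℤ_)
open import Data.Integer.Tactic.RingSolver using (solve-∀)
open import Data.Product using (_×_; _,_; proj₁; proj₂)
open import Algebra.Bundles using (AbelianGroup)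
open import Function.Bundles using (_⇔_; mk⇔)
open import Relation.Binary.Structures using (IsPartialOrder)
open import Relation.Binary.PropositionalEquality using (_≡_; cong; subst)
import Relation.Binary.PropositionalEquality as ≡
import Relation.Binary.Reasoning.Setoid as SetoidReasoning
import Algebra.Properties.AbelianGroup as AbelianGroupProperties
import Algebra.Properties.Loop as LoopProperties

module AbelianGroupDifferences {a ℓ} (G : AbelianGroup a ℓ) where
  open AbelianGroup G
  open AbelianGroupProperties G using (⁻¹-anti-homo‿-)
  open SetoidReasoning setoid

  [x-y]∙[y-z]≈x-z : ∀ x y z → (x - y) ∙ (y - z) ≈ x - z
  [x-y]∙[y-z]≈x-z x y z = begin
    (x ∙ y ⁻¹) ∙ (y ∙ z ⁻¹)  ≈⟨ assoc _ _ _ ⟩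
    x ∙ (y ⁻¹ ∙ (y ∙ z ⁻¹))  ≈⟨ ∙-congˡ (assoc _ _ _) ⟨
    x ∙ ((y ⁻¹ ∙ y) ∙ z ⁻¹)  ≈⟨ ∙-congˡ (∙-congʳ (inverseˡ y)) ⟩
    x ∙ (ε ∙ z ⁻¹)           ≈⟨ ∙-congˡ (identityˡ _) ⟩
    x ∙ z ⁻¹                 ∎

  x-[y-z]≈x∙z-y : ∀ x y z → x - (y - z) ≈ x ∙ z - y
  x-[y-z]≈x∙z-y x y z = begin
    x ∙ (y ∙ z ⁻¹) ⁻¹       ≈⟨ ∙-congˡ (⁻¹-anti-homo‿- y z) ⟩
    x ∙ (z ∙ y ⁻¹)          ≈⟨ assoc _ _ _ ⟨
    x ∙ z ∙ y ⁻¹            ∎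

module Telescoping {a ℓ a' ℓ₁ ℓ₂ : Level} (H : AbelianGroup a ℓ) (V : OrderedCommMonoid a' ℓ₁ ℓ₂) where
  open AbelianGroup H
  open AbelianGroupDifferences H
  open SetoidReasoning setoid

  sumBelow-telescope↑ : (g h : ℕ → Carrier) → (∀ i → g i ≈ h (suc i) - h i) →
                        ∀ n → sumBelow H V n g ≈ h n - h 0
  sumBelow-telescope↑ g h step zero    = sym (inverseʳ (h 0))
  sumBelow-telescope↑ g h step (suc n) = begin
    sumBelow H V n g ∙ g n           ≈⟨ ∙-cong (sumBelow-telescope↑ g h step n) (step n) ⟩
    (h n - h 0) ∙ (h (suc n) - h n)  ≈⟨ comm _ _ ⟩
    (h (suc n) - h n) ∙ (h n - h 0)  ≈⟨ [x-y]∙[y-z]≈x-z _ _ _ ⟩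
    h (suc n) - h 0                  ∎

  sumBelow-telescope↓ : (g h : ℕ → Carrier) → (∀ i → g i ≈ h i - h (suc i)) →
                        ∀ n → sumBelow H V n g ≈ h 0 - h n
  sumBelow-telescope↓ g h step zero    = sym (inverseʳ (h 0))
  sumBelow-telescope↓ g h step (suc n) = begin
    sumBelow H V n g ∙ g n           ≈⟨ ∙-cong (sumBelow-telescope↓ g h step n) (step n) ⟩
    (h 0 - h n) ∙ (h n - h (suc n))  ≈⟨ [x-y]∙[y-z]≈x-z _ _ _ ⟩
    h 0 - h (suc n)                  ∎

module Increments {a ℓ a' ℓ₁ ℓ₂ : Level} (H : AbelianGroup a ℓ) (V : OrderedCommMonoid a' ℓ₁ ℓ₂)
                  (f : ℤ → AbelianGroup.Carrier H) where
  open AbelianGroup H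
  open Telescoping H V

  f-cong : ∀ {x y} → x ≡ y → f x ≈ f y
  f-cong x≡y = reflexive (cong f x≡y)

  sumBelow-Δ-ascending : (g : ℕ → ℤ) → (∀ i → g i +ℤ + 1 ≡ g (suc i)) →
                         ∀ n → sumBelow H V n (λ i → Δ H V f (g i)) ≈ f (g n) - f (g 0)
  sumBelow-Δ-ascending g step =
    sumBelow-telescope↑ _ (λ i → f (g i)) (λ i → ∙-congʳ (f-cong (step i)))

  sumBelow-Δ-descending : (g : ℕ → ℤ) → (∀ i → g (suc i) +ℤ + 1 ≡ g i) →
                          ∀ n → sumBelow H V n (λ i → Δ H V f (g i)) ≈ f (g 0 +ℤ + 1) - f (g n +ℤ + 1)
  sumBelow-Δ-descending g step =
    sumBelow-telescope↓ _ (λ i → f (g i +ℤ + 1)) (λ i → ∙-congˡ (⁻¹-cong (f-cong (≡.sym (step i)))))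

module QuasiHomCriterion {a ℓ a' ℓ₁ ℓ₂ : Level} (H : AbelianGroup a ℓ) (V : OrderedCommMonoid a' ℓ₁ ℓ₂)
    (‖_‖ : AbelianGroup.Carrier H → OrderedCommMonoid.Carrier V) (isNorm : IsNorm H V ‖_‖)
    (c : OrderedCommMonoid.Carrier V)
    (f : ℤ → AbelianGroup.Carrier H) (f1≈ε : AbelianGroup._≈_ H (f (+ 1)) (AbelianGroup.ε H)) where
  open AbelianGroup H
  open AbelianGroupDifferences H
  open AbelianGroupProperties H using (loop; ⁻¹-anti-homo‿-)
  open LoopProperties loop using (x//ε≈x)
  open Increments H V f
  open SetoidReasoning setoid
  open IsNorm isNorm using (symmetric) renaming (cong to ‖‖-cong)
  module V = OrderedCommMonoid V
  module ≤ = IsPartialOrder V.isPartialOrder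

  defect : ℤ → ℤ → Carrier
  defect x y = (f (x +ℤ y) - f x) - f y

  sumDiff₁ sumDiff₂ : ℕ → ℤ → Carrier
  sumDiff₁ k z = sumBelow H V k (λ i → Δ H V f (+ suc i)) - sumBelow H V (suc k) (λ i → Δ H V f (z -ℤ + i))
  sumDiff₂ k z = sumBelow H V (suc k) (λ i → Δ H V f (- (+ i))) - sumBelow H V k (λ i → Δ H V f (z -ℤ + i))

  sumBelow-Δ-positive : ∀ k → sumBelow H V k (λ i → Δ H V f (+ suc i)) ≈ f (+ suc k) - f (+ 1)
  sumBelow-Δ-positive = sumBelow-Δ-ascending (λ i → + suc i) (λ i → 1+w+1≡1+[1+w] (+ i))
    where 1+w+1≡1+[1+w] : ∀ w → + 1 +ℤ w +ℤ + 1 ≡ + 1 +ℤ (+ 1 +ℤ w)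
          1+w+1≡1+[1+w] = solve-∀

  -[1+w]+1≡-w : ∀ w → - (+ 1 +ℤ w) +ℤ + 1 ≡ - w
  -[1+w]+1≡-w = solve-∀

  sumBelow-Δ-nonpositive : ∀ k → sumBelow H V k (λ i → Δ H V f (- (+ i))) ≈ f (+ 1) - f (- (+ k) +ℤ + 1)
  sumBelow-Δ-nonpositive = sumBelow-Δ-descending (λ i → - (+ i)) (λ i → -[1+w]+1≡-w (+ i))

  z-[1+w]+1≡z-w : ∀ z w → z -ℤ (+ 1 +ℤ w) +ℤ + 1 ≡ z -ℤ w
  z-[1+w]+1≡z-w = solve-∀

  sumBelow-Δ-below : ∀ z k → sumBelow H V k (λ i → Δ H V f (z -ℤ + i)) ≈ f (z +ℤ + 1) - f (z -ℤ + k +ℤ + 1)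
  sumBelow-Δ-below z k = begin
    sumBelow H V k (λ i → Δ H V f (z -ℤ + i))  ≈⟨ sumBelow-Δ-descending (λ i → z -ℤ + i) (λ i → z-[1+w]+1≡z-w z (+ i)) k ⟩
    f (z -ℤ + 0 +ℤ + 1) - f (z -ℤ + k +ℤ + 1) ≈⟨ ∙-congʳ (f-cong (z-0+1≡z+1 z)) ⟩
    f (z +ℤ + 1) - f (z -ℤ + k +ℤ + 1)        ∎
    where z-0+1≡z+1 : ∀ z → z -ℤ + 0 +ℤ + 1 ≡ z +ℤ + 1
          z-0+1≡z+1 = solve-∀

  sumDiff₁≈defect⁻¹ : ∀ k z → sumDiff₁ k z ≈ defect (+ suc k) (z -ℤ + k) ⁻¹
  sumDiff₁≈defect⁻¹ k z = begin
    sumDiff₁ k z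
      ≈⟨ ∙-cong (sumBelow-Δ-positive k) (⁻¹-cong (sumBelow-Δ-below z (suc k))) ⟩
    (f (+ suc k) - f (+ 1)) - (f (z +ℤ + 1) - f (z -ℤ + suc k +ℤ + 1))
      ≈⟨ ∙-cong (trans (∙-congˡ (⁻¹-cong f1≈ε)) (x//ε≈x _)) (⁻¹-cong (∙-congˡ (⁻¹-cong (f-cong (z-[1+w]+1≡z-w z (+ k)))))) ⟩
    f (+ suc k) - (f (z +ℤ + 1) - f (z -ℤ + k))
      ≈⟨ x-[y-z]≈x∙z-y _ _ _ ⟩
    f (+ suc k) ∙ f (z -ℤ + k) - f (z +ℤ + 1)
      ≈⟨ ∙-congʳ (comm _ _) ⟩
    f (z -ℤ + k) ∙ f (+ suc k) - f (z +ℤ + 1)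
      ≈⟨ x-[y-z]≈x∙z-y _ _ _ ⟨
    f (z -ℤ + k) - (f (z +ℤ + 1) - f (+ suc k))
      ≈⟨ ⁻¹-anti-homo‿- _ _ ⟨
    ((f (z +ℤ + 1) - f (+ suc k)) - f (z -ℤ + k)) ⁻¹
      ≈⟨ ⁻¹-cong (∙-congʳ (∙-congʳ (f-cong (1+w+[z-w]≡z+1 z (+ k))))) ⟨
    defect (+ suc k) (z -ℤ + k) ⁻¹ ∎
    where 1+w+[z-w]≡z+1 : ∀ z w → + 1 +ℤ w +ℤ (z -ℤ w) ≡ z +ℤ + 1
          1+w+[z-w]≡z+1 = solve-∀

  sumDiff₂≈defect : ∀ k z → sumDiff₂ k z ≈ defect (- (+ k)) (z +ℤ + 1)
  sumDiff₂≈defect k z = begin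
    sumDiff₂ k z
      ≈⟨ ∙-cong (sumBelow-Δ-nonpositive (suc k)) (⁻¹-cong (sumBelow-Δ-below z k)) ⟩
    (f (+ 1) - f (- (+ suc k) +ℤ + 1)) - (f (z +ℤ + 1) - f (z -ℤ + k +ℤ + 1))
      ≈⟨ ∙-congʳ (∙-cong f1≈ε (⁻¹-cong (f-cong (-[1+w]+1≡-w (+ k))))) ⟩
    (ε - f (- (+ k))) - (f (z +ℤ + 1) - f (z -ℤ + k +ℤ + 1))
      ≈⟨ x-[y-z]≈x∙z-y _ _ _ ⟩
    (ε - f (- (+ k))) ∙ f (z -ℤ + k +ℤ + 1) - f (z +ℤ + 1)
      ≈⟨ ∙-congʳ (trans (∙-congʳ (identityˡ _)) (comm _ _)) ⟩
    (f (z -ℤ + k +ℤ + 1) - f (- (+ k))) - f (z +ℤ + 1)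
      ≈⟨ ∙-congʳ (∙-congʳ (f-cong (-w+[z+1]≡z-w+1 z (+ k)))) ⟨
    defect (- (+ k)) (z +ℤ + 1) ∎
    where -w+[z+1]≡z-w+1 : ∀ z w → - w +ℤ (z +ℤ + 1) ≡ z -ℤ w +ℤ + 1
          -w+[z+1]≡z-w+1 = solve-∀

  ‖sumDiff₁‖≈‖defect‖ : ∀ k z → ‖ sumDiff₁ k z ‖ V.≈ ‖ defect (+ suc k) (z -ℤ + k) ‖
  ‖sumDiff₁‖≈‖defect‖ k z = ≤.Eq.trans (‖‖-cong (sumDiff₁≈defect⁻¹ k z)) (symmetric _)

  ‖sumDiff₂‖≈‖defect‖ : ∀ k z → ‖ sumDiff₂ k z ‖ V.≈ ‖ defect (- (+ k)) (z +ℤ + 1) ‖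
  ‖sumDiff₂‖≈‖defect‖ k z = ‖‖-cong (sumDiff₂≈defect k z)

  SumDiffsBounded : Set ℓ₂
  SumDiffsBounded = ∀ k z → (‖ sumDiff₁ k z ‖ V.≤ c) × (‖ sumDiff₂ k z ‖ V.≤ c)

  quasiHom⇒sumDiffsBounded : IsQuasiHom H V ‖_‖ c f → SumDiffsBounded
  quasiHom⇒sumDiffsBounded quasiHom k z =
      ≤.≲-respˡ-≈ (≤.Eq.sym (‖sumDiff₁‖≈‖defect‖ k z)) (quasiHom _ _)
    , ≤.≲-respˡ-≈ (≤.Eq.sym (‖sumDiff₂‖≈‖defect‖ k z)) (quasiHom _ _)

  defect-bounded-positive : SumDiffsBounded → ∀ n y → ‖ defect (+ suc n) y ‖ V.≤ c
  defect-bounded-positive bounded n y =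
    subst (λ w → ‖ defect (+ suc n) w ‖ V.≤ c) (y+w-w≡y y (+ n))
      (≤.≲-respˡ-≈ (‖sumDiff₁‖≈‖defect‖ n (y +ℤ + n)) (proj₁ (bounded n (y +ℤ + n))))
    where y+w-w≡y : ∀ y w → y +ℤ w -ℤ w ≡ y
          y+w-w≡y = solve-∀

  defect-bounded-nonpositive : SumDiffsBounded → ∀ k y → ‖ defect (- (+ k)) y ‖ V.≤ c
  defect-bounded-nonpositive bounded k y =
    subst (λ w → ‖ defect (- (+ k)) w ‖ V.≤ c) (y-1+1≡y y)
      (≤.≲-respˡ-≈ (‖sumDiff₂‖≈‖defect‖ k (y -ℤ + 1)) (proj₂ (bounded k (y -ℤ + 1))))
    where y-1+1≡y : ∀ y → y -ℤ + 1 +ℤ + 1 ≡ y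
          y-1+1≡y = solve-∀

  sumDiffsBounded⇒quasiHom : SumDiffsBounded → IsQuasiHom H V ‖_‖ c f
  sumDiffsBounded⇒quasiHom bounded (+ suc n) = defect-bounded-positive bounded n
  sumDiffsBounded⇒quasiHom bounded (+ zero)  = defect-bounded-nonpositive bounded zero
  sumDiffsBounded⇒quasiHom bounded -[1+ n ]  = defect-bounded-nonpositive bounded (suc n)

lemma3p4 : ∀ {a ℓ a' ℓ₁ ℓ₂ : Level} (H : AbelianGroup a ℓ) (V : OrderedCommMonoid a' ℓ₁ ℓ₂)
    (‖_‖ : AbelianGroup.Carrier H → OrderedCommMonoid.Carrier V) → IsNorm H V ‖_‖ →
    (c : OrderedCommMonoid.Carrier V) → OrderedCommMonoid._≤_ V (OrderedCommMonoid.0# V) c →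
    (f : ℤ → AbelianGroup.Carrier H) → AbelianGroup._≈_ H (f (+ 1)) (AbelianGroup.ε H) →
    IsQuasiHom H V ‖_‖ c f
    ⇔ (∀ (k : ℕ) (z : ℤ) →
        (OrderedCommMonoid._≤_ V
          ‖ _-H_ H V (sumBelow H V k (λ i → Δ H V f (+ suc i)))
                   (sumBelow H V (suc k) (λ i → Δ H V f (z -ℤ + i))) ‖ c)
        × OrderedCommMonoid._≤_ V
          ‖ _-H_ H V (sumBelow H V (suc k) (λ i → Δ H V f (- (+ i))))
                   (sumBelow H V k (λ i → Δ H V f (z -ℤ + i))) ‖ c)
lemma3p4 H V ‖_‖ isNorm c _ f f1≈ε = mk⇔ quasiHom⇒sumDiffsBounded sumDiffsBounded⇒quasiHom
  where open QuasiHomCriterion H V ‖_‖ isNorm c f f1≈ε
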